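{- Let $A\subset\mathbb{N}_0$ be a finite 3-free set and $S(A)$ the Stanley sequence generated by $A$. Then for every real $x\ge 0$, \[ \#\{n\in\mathbb{Z}: 0\le n\le x,\ n\notin S(A)\} - \max A \le \sum_{0\le n\le x} H(S(A),n), \] where the sum is over integers $n$.
   Context: $\mathbb{N}_0$ denotes the set of nonnegative integers. A subset of $\mathbb{N}_0$ is 3-free if it contains no three-term arithmetic progression. Given a finite 3-free set $A=\{a_1,\dots,a_t\}\subset\mathbb{N}_0$ with $a_1<\dots<a_t$, the Stanley sequence generated by $A$ is the infinite sequence $S(A)=\{a_1,a_2,a_3,\dots\}$ defined recursively: for $k\ge t$, once $a_1<\dots<a_k$ are defined, $a_{k+1}$ is the smallest integer $a>a_k$ such that $\{a_1,\dots,a_k\}\cup\{a\}$ is 3-free. For $S\subset\mathbb{N}_0$ and an integer $n$, $H(S,n)=\#\{(s_1,s_2): s_1,s_2\in S,\ s_1<s_2,\ n=2s_2-s_1\}$. -}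

module Defs where

open import Data.Nat using (ℕ; zero; suc; _+_; _*_; _≤_; _<_)
open import Data.Nat.Properties using (_≟_)
open import Data.Bool using (Bool; true; false; _∧_; if_then_else_)
open import Data.Fin using (Fin; toℕ; fromℕ)
open import Data.Vec using (Vec; lookup)
open import Data.List using (List; map; upTo)
open import Data.Nat.ListAction using (sum)
open import Data.Product using (Σ; ∃; _×_)
open import Data.Sum using (_⊎_)
open import Relation.Nullary using (¬_)
open import Relation.Nullary.Decidable using (⌊_⌋)
open import Relation.Binary.PropositionalEquality using (_≡_; _≢_)

ThreeFree : (ℕ → Set) → Set
ThreeFree P = ∀ x y z → P x → P y → P z → x < y → y < z → x + z ≢ 2 * y

-- The finite set A = {a₀ < … < a_t} given as a vector of length t+1.
StrictlyIncreasing : ∀ {t} → Vec ℕ t → Set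
StrictlyIncreasing {t} A = ∀ (i j : Fin t) → toℕ i < toℕ j → lookup A i < lookup A j

InVec : ∀ {t} → Vec ℕ t → ℕ → Set
InVec {t} A x = Σ (Fin t) λ i → lookup A i ≡ x

-- max A (A strictly increasing, so the last entry)
maxA : ∀ {t} → Vec ℕ (suc t) → ℕ
maxA {t} A = lookup A (fromℕ t)

Prefix : (ℕ → ℕ) → ℕ → ℕ → Set
Prefix a k x = Σ ℕ λ i → i ≤ k × a i ≡ x

-- a : ℕ → ℕ is the Stanley sequence S(A) (0-indexed: a 0 < … < a t are the
-- elements of A, and for k ≥ t, a (k+1) is the smallest integer > a k such
-- that {a 0,…,a k} ∪ {a (k+1)} is 3-free).
IsStanley : ∀ {t} → Vec ℕ (suc t) → (ℕ → ℕ) → Set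
IsStanley {t} A a =
  (∀ (i : Fin (suc t)) → a (toℕ i) ≡ lookup A i)
  × (∀ k → t ≤ k →
       (a k < a (suc k))
       × ThreeFree (Prefix a (suc k))
       × (∀ m → a k < m → m < a (suc k) →
            ¬ ThreeFree (λ x → Prefix a k x ⊎ x ≡ m)))

count : List ℕ → (ℕ → Bool) → ℕ
count xs p = sum (map (λ x → if p x then 1 else 0) xs)

range : ℕ → List ℕ
range N = upTo (suc N)

-- H(S,n) = #{(s₁,s₂) : s₁,s₂ ∈ S, s₁ < s₂, n = 2 s₂ − s₁}
-- (for n ≥ 0 any such pair has s₂ ≤ n, so enumerating s₂ ∈ [0..n],
--  s₁ ∈ [0..s₂) is exhaustive)
H : (ℕ → Bool) → ℕ → ℕ
H S n = sum (map (λ s₂ → count (upTo s₂)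
                   (λ s₁ → S s₁ ∧ S s₂ ∧ ⌊ n + s₁ ≟ 2 * s₂ ⌋)) (range n))

nonMembers : (ℕ → Bool) → ℕ → ℕ
nonMembers S N = count (range N) (λ n → if S n then false else true)

sumH : (ℕ → Bool) → ℕ → ℕ
sumH S N = sum (map (H S) (range N))

module Submission where

-- Split the interval [0, N] into the integers below max A and the rest.
-- There are at most max A integers of the first kind.  An integer n > max A
-- that is missing from S(A) was skipped by the greedy construction: if
-- a k < n < a (k+1), then {a 0, …, a k} ∪ {n} contains a 3-term progression.
-- Its largest term must be n (the prefix up to a (k+1) is 3-free), so
-- n = 2 s₂ − s₁ for some s₁ < s₂ in S(A), i.e. H(S(A), n) ≥ 1.  Hence
--   [n ∉ S]  ≤  H(S, n) + [n < max A]   for every n,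
-- and summing over 0 ≤ n ≤ N gives the theorem.

open import Defs
open import Data.Nat using (ℕ; zero; suc; _+_; _*_; _∸_; _≤_; _<_; z≤n; s≤s)
open import Data.Nat.Properties
open import Algebra.Properties.CommutativeSemigroup +-commutativeSemigroup
  using (interchange)
open import Data.Vec using (Vec; lookup)
open import Data.Bool using (Bool; true; false; _∧_; if_then_else_)
open import Data.Fin using (fromℕ; fromℕ<)
open import Data.Fin.Properties using (toℕ-fromℕ; toℕ-fromℕ<)
open import Data.List using ([]; _∷_; map; upTo; applyUpTo)
open import Data.Nat.ListAction using (sum)
open import Data.List.Membership.Propositional using (_∈_)
open import Data.List.Membership.Propositional.Properties using (∈-upTo⁺)
open import Data.List.Relation.Unary.Any using (here; there)
open import Data.Product using (Σ; _×_; _,_; proj₁; proj₂)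
open import Data.Sum using (_⊎_; inj₁; inj₂)
open import Relation.Nullary using (¬_; yes; no; contradiction)
open import Relation.Nullary.Decidable using (⌊_⌋)
open import Relation.Binary.PropositionalEquality
open import Function.Bundles using (_⇔_; Equivalence)

indicator : Bool → ℕ
indicator b = if b then 1 else 0

sum-map-pos : ∀ (g : ℕ → ℕ) {xs x} → x ∈ xs → 0 < g x → 0 < sum (map g xs)
sum-map-pos g {y ∷ ys} (here refl) gx>0 = ≤-trans gx>0 (m≤m+n (g y) _)
sum-map-pos g {y ∷ ys} (there x∈ys) gx>0 =
  ≤-trans (sum-map-pos g x∈ys gx>0) (m≤n+m _ (g y))

sum-map-≤-+ : ∀ (f g h : ℕ → ℕ) → (∀ x → f x ≤ g x + h x) → ∀ xs →
              sum (map f xs) ≤ sum (map g xs) + sum (map h xs)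
sum-map-≤-+ f g h f≤g+h []       = z≤n
sum-map-≤-+ f g h f≤g+h (x ∷ xs) =
  ≤-trans (+-mono-≤ (f≤g+h x) (sum-map-≤-+ f g h f≤g+h xs))
          (≤-reflexive (interchange (g x) (h x) (sum (map g xs)) (sum (map h xs))))

shift-lower-bound : ∀ d (f : ℕ → ℕ) → (∀ i → d + i ≤ f i) →
                    ∀ i → suc d + i ≤ f (suc i)
shift-lower-bound d f f-big i = subst (_≤ f (suc i)) (+-suc d i) (f-big (suc i))

count-below : ∀ M d k (f : ℕ → ℕ) → (∀ i → d + i ≤ f i) →
              count (applyUpTo f k) (λ n → ⌊ n <? M ⌋) ≤ M ∸ d
count-below M d zero    f f-big = z≤n
count-below M d (suc k) f f-big with f 0 <? M
... | yes f0<M = begin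
  suc (count (applyUpTo (λ i → f (suc i)) k) _)  ≤⟨ s≤s count-tail ⟩  
  suc (M ∸ suc d)                                ≡⟨ +-∸-assoc 1 d<M ⟨
  M ∸ d                                          ∎
  where
  open ≤-Reasoning
  count-tail : count (applyUpTo (λ i → f (suc i)) k) (λ n → ⌊ n <? M ⌋) ≤ M ∸ suc d
  count-tail = count-below M (suc d) k (λ i → f (suc i)) (shift-lower-bound d f f-big)
  d<M : d < M
  d<M = ≤-<-trans (subst (_≤ f 0) (+-identityʳ d) (f-big 0)) f0<M
... | no _ = ≤-trans (count-below M (suc d) k (λ i → f (suc i)) (shift-lower-bound d f f-big))
                     (∸-monoʳ-≤ M (n≤1+n d))

middle<last : ∀ {n x y} → x < y → n + x ≡ 2 * y → y < n
middle<last {n} {x} {y} x<y n+x≡2y with y <? n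
... | yes y<n = y<n
... | no  y≮n = contradiction (+-mono-≤-< (≮⇒≥ y≮n) x<y) (<-irrefl n+x≡y+y)
  where
  n+x≡y+y : n + x ≡ y + y
  n+x≡y+y = trans n+x≡2y (cong (y +_) (+-identityʳ y))

H-pos : ∀ (S : ℕ → Bool) {n s₁ s₂} → S s₁ ≡ true → S s₂ ≡ true → s₁ < s₂ →
        n + s₁ ≡ 2 * s₂ → 0 < H S n
H-pos S {n} {s₁} {s₂} S-s₁ S-s₂ s₁<s₂ n+s₁≡2s₂ =
  sum-map-pos row (∈-upTo⁺ (s≤s (<⇒≤ (middle<last s₁<s₂ n+s₁≡2s₂))))
    (sum-map-pos (entry s₂) (∈-upTo⁺ s₁<s₂) pair-counted)
  where
  entry : ℕ → ℕ → ℕ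
  entry y x = indicator (S x ∧ S y ∧ ⌊ n + x ≟ 2 * y ⌋)
  row : ℕ → ℕ
  row y = sum (map (entry y) (upTo y))
  pair-counted : 0 < entry s₂ s₁
  pair-counted rewrite S-s₁ | S-s₂ with n + s₁ ≟ 2 * s₂
  ... | yes _  = s≤s z≤n
  ... | no  ne = contradiction n+s₁≡2s₂ ne

module IncreasingSequence (a : ℕ → ℕ) (a-step : ∀ i → a i < a (suc i)) where

  monotone : ∀ {i k} → i ≤ k → a i ≤ a k
  monotone {i} {k} i≤k = subst (λ j → a i ≤ a j) (m∸n+n≡m i≤k) (shifted (k ∸ i))
    where
    shifted : ∀ d → a i ≤ a (d + i)
    shifted zero    = ≤-refl
    shifted (suc d) = ≤-trans (shifted d) (<⇒≤ (a-step (d + i)))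

  index≤value : ∀ i → i ≤ a i
  index≤value zero    = z≤n
  index≤value (suc i) = ≤-trans (s≤s (index≤value i)) (a-step i)

  bracket : ∀ j n → a j < n → Σ ℕ λ k → j ≤ k × a k < n × n ≤ a (suc k)
  bracket j n aj<n = search n (≤-trans (m≤m+n n j) (index≤value (n + j)))
    where
    search : ∀ m → n ≤ a (m + j) → Σ ℕ λ k → j ≤ k × a k < n × n ≤ a (suc k)
    search zero    n≤aj = contradiction n≤aj (<⇒≱ aj<n)
    search (suc m) n≤a[m+1+j] with n ≤? a (m + j)
    ... | yes n≤a[m+j] = search m n≤a[m+j]
    ... | no  n≰a[m+j] = m + j , m≤n+m j m , ≰⇒> n≰a[m+j] , n≤a[m+1+j]

module StanleySequence {t} (A : Vec ℕ (suc t)) (A-incr : StrictlyIncreasing A)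
  (a : ℕ → ℕ) (stanley : IsStanley A a)
  (S : ℕ → Bool) (a∈S : ∀ i → S (a i) ≡ true) where

  starts-with-A : ∀ i (i<1+t : i < suc t) → a i ≡ lookup A (fromℕ< i<1+t)
  starts-with-A i i<1+t = trans (cong a (sym (toℕ-fromℕ< i<1+t))) (proj₁ stanley (fromℕ< i<1+t))

  a-t≡maxA : a t ≡ maxA A
  a-t≡maxA = trans (cong a (sym (toℕ-fromℕ t))) (proj₁ stanley (fromℕ t))

  greedy-step : ∀ k → t ≤ k → a k < a (suc k)
  greedy-step k t≤k = proj₁ (proj₂ stanley k t≤k)

  greedy-3-free : ∀ k → t ≤ k → ThreeFree (Prefix a (suc k))
  greedy-3-free k t≤k = proj₁ (proj₂ (proj₂ stanley k t≤k))

  greedy-minimal : ∀ k → t ≤ k → ∀ n → a k < n → n < a (suc k) →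
                   ¬ ThreeFree (λ x → Prefix a k x ⊎ x ≡ n)
  greedy-minimal k t≤k = proj₂ (proj₂ (proj₂ stanley k t≤k))

  a-step : ∀ i → a i < a (suc i)
  a-step i with suc i ≤? t
  ... | no  i+1≰t = greedy-step i (≤-pred (≰⇒> i+1≰t))
  ... | yes i+1≤t = subst₂ _<_ (sym (starts-with-A i i<1+t)) (sym (starts-with-A (suc i) (s≤s i+1≤t)))
                      (A-incr _ _ (subst₂ _<_ (sym (toℕ-fromℕ< i<1+t)) (sym (toℕ-fromℕ< (s≤s i+1≤t)))
                                               (n<1+n i)))
    where
    i<1+t : i < suc t
    i<1+t = ≤-trans (n≤1+n (suc i)) (s≤s i+1≤t)

  open IncreasingSequence a a-step

  prefix≤last : ∀ {k x} → Prefix a k x → x ≤ a k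
  prefix≤last (i , i≤k , refl) = monotone i≤k

  prefix⊆S : ∀ {k x} → Prefix a k x → S x ≡ true
  prefix⊆S (i , _ , refl) = a∈S i

  below-n : ∀ {k n x} → x < n → Prefix a k x ⊎ x ≡ n → Prefix a k x
  below-n _   (inj₁ x∈pre) = x∈pre
  below-n x<n (inj₂ refl)  = contradiction x<n (<-irrefl refl)

  prefix-extend : ∀ {k x} → Prefix a k x → Prefix a (suc k) x
  prefix-extend (i , i≤k , eq) = i , m≤n⇒m≤1+n i≤k , eq

  -- If H(S, n) = 0, adjoining n to the prefix a 0, …, a k (with a k < n)
  -- creates no progression: one ending in n would be counted by H(S, n),
  -- and one inside the prefix is excluded by the greedy construction.
  adjoin-3-free : ∀ k n → t ≤ k → a k < n → H S n ≡ 0 →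
                  ThreeFree (λ x → Prefix a k x ⊎ x ≡ n)
  adjoin-3-free k n t≤k ak<n H≡0 x y z x∈ y∈ z∈ x<y y<z x+z≡2y with z∈
  ... | inj₂ refl = <-irrefl (sym H≡0)
                      (H-pos S (prefix⊆S (below-n (<-trans x<y y<z) x∈)) (prefix⊆S (below-n y<z y∈)) x<y
                             (trans (+-comm z x) x+z≡2y))
  ... | inj₁ z∈pre = greedy-3-free k t≤k x y z (prefix-extend (below-n x<n x∈)) (prefix-extend (below-n y<n y∈))
                       (prefix-extend z∈pre) x<y y<z x+z≡2y
    where
    y<n : y < n
    y<n = <-trans y<z (≤-<-trans (prefix≤last z∈pre) ak<n)
    x<n : x < n
    x<n = <-trans x<y y<n

  missing⇒H-pos : ∀ n → S n ≡ false → maxA A < n → 0 < H S n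
  missing⇒H-pos n n∉S maxA<n with bracket t n (subst (_< n) (sym a-t≡maxA) maxA<n)
  ... | k , t≤k , ak<n , n≤ak+1 = n≢0⇒n>0 λ H≡0 →
        greedy-minimal k t≤k n ak<n n<ak+1 (adjoin-3-free k n t≤k ak<n H≡0)
    where
    n<ak+1 : n < a (suc k)
    n<ak+1 with m≤n⇒m<n∨m≡n n≤ak+1
    ... | inj₁ n<ak+1 = n<ak+1
    ... | inj₂ refl   = contradiction (trans (sym n∉S) (a∈S (suc k))) λ ()

  missing≤H+below : ∀ n → indicator (if S n then false else true)
                          ≤ H S n + indicator ⌊ n <? maxA A ⌋
  missing≤H+below n with S n in S-n | n <? maxA A
  ... | true  | _         = z≤n
  ... | false | yes _     = m≤n+m 1 (H S n)
  ... | false | no  n≮max with m≤n⇒m<n∨m≡n (≮⇒≥ n≮max)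
  ...   | inj₁ max<n = ≤-trans (missing⇒H-pos n S-n max<n) (m≤m+n (H S n) 0)
  ...   | inj₂ refl  = contradiction (trans (sym S-n) (trans (cong S (sym a-t≡maxA)) (a∈S t))) λ ()

lemma3 : ∀ {t} (A : Vec ℕ (suc t)) → StrictlyIncreasing A → ThreeFree (InVec A)
    → (a : ℕ → ℕ) → IsStanley A a
    → (S : ℕ → Bool) → (∀ n → (S n ≡ true) ⇔ Σ ℕ (λ i → a i ≡ n))
    → (N : ℕ) → nonMembers S N ≤ sumH S N + maxA A
lemma3 A A-incr _ a stanley S S⇔a N = begin
  nonMembers S N                                              ≤⟨ split ⟩
  sumH S N + count (range N) (λ n → ⌊ n <? maxA A ⌋)          ≤⟨ +-monoʳ-≤ (sumH S N) few-below ⟩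
  sumH S N + maxA A                                           ∎
  where
  open ≤-Reasoning
  open StanleySequence A A-incr a stanley S (λ i → Equivalence.from (S⇔a (a i)) (i , refl))
  split : nonMembers S N ≤ sumH S N + count (range N) (λ n → ⌊ n <? maxA A ⌋)
  split = sum-map-≤-+ _ (H S) _ missing≤H+below (range N)
  few-below : count (range N) (λ n → ⌊ n <? maxA A ⌋) ≤ maxA A
  few-below = count-below (maxA A) 0 (suc N) (λ i → i) (λ i → ≤-refl)
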